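{- Let $G$ be a finite abelian group, $\Gamma \subseteq \hat G$ with $k = |\Gamma|$, and $\rho > 0$. Let $A \subseteq B(\Gamma; \rho)$ be a set of size at least $(1 - 4^{ -k-1})|B(\Gamma; \rho)|$. Then $A - A \supseteq B(\Gamma; \rho/2)$.
   Context: $\hat{G}$ is the group of homomorphisms $G\to\mathbb{T}=\mathbb{R}/\mathbb{Z}$; $|t|_{\mathbb{T}}$ is the distance of $t$ to $0+\mathbb{Z}$; $B(\Gamma;\rho)=\{x\in G:|\gamma(x)|_{\mathbb{T}}\le\rho\ \forall\gamma\in\Gamma\}$.
   Formalization: The radius ρ ranges over the positive rationals. -}

module Defs where

open import Data.Nat as ℕ using (ℕ; suc)
open import Data.Fin using (Fin)
import Data.Fin as F
open import Data.Product using (_×_)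
open import Data.Fin.Subset using (Subset; _∈_)
open import Data.Vec using (tabulate)
open import Data.Bool using (Bool; true; false; _∧_)
open import Data.Rational using (ℚ; 0ℚ; 1ℚ; _+_; _-_; _≤_; _<_; _⊓_; floor; _/_)
open import Data.Rational.Properties using (_≤?_)
open import Relation.Nullary using (does)
open import Relation.Binary.PropositionalEquality using (_≡_)
open import Algebra.Structures using (IsAbelianGroup)

-- A finite abelian group, presented (up to isomorphism) on the carrier Fin order,
-- with propositional equality.
record FinAbGroup : Set where
  field
    order : ℕ
    _∙_   : Fin order → Fin order → Fin order
    ε     : Fin order
    _⁻¹   : Fin order → Fin order
    isAbelianGroup : IsAbelianGroup _≡_ _∙_ ε _⁻¹

  _⊖_ : Fin order → Fin order → Fin order
  a ⊖ b = a ∙ (b ⁻¹)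

-- 𝕋 = ℝ/ℤ; a character G → 𝕋 takes values of finite order, hence in ℚ/ℤ.
-- We represent elements of ℚ/ℤ by their canonical representative in [0,1).
frac : ℚ → ℚ
frac q = q - (floor q / 1)

∣_∣𝕋 : ℚ → ℚ
∣ t ∣𝕋 = frac t ⊓ (1ℚ - frac t)

record Character (G : FinAbGroup) : Set where
  open FinAbGroup G
  field
    χ      : Fin order → ℚ
    range  : ∀ x → 0ℚ ≤ χ x × χ x < 1ℚ
    hom    : ∀ x y → χ (x ∙ y) ≡ frac (χ x + χ y)

open Character public

bohr : (G : FinAbGroup) {k : ℕ} → (Fin k → Character G) → ℚ →
       Subset (FinAbGroup.order G)
bohr G {k} Γ ρ = tabulate (λ x → allFin (λ i → does (∣ χ (Γ i) x ∣𝕋 ≤? ρ)))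
  where
  allFin : {m : ℕ} → (Fin m → Bool) → Bool
  allFin {ℕ.zero} f = true
  allFin {suc m} f = f F.zero ∧ allFin (λ i → f (F.suc i))

module Submission where

-- If x ∉ A - A, then for each y ∈ B(Γ; ρ/2) both y and y + x lie in B(Γ; ρ)
-- but not both lie in A, so |B(Γ; ρ/2)| ≤ 2 |B(Γ; ρ) ∖ A| ≤ 2 · 4^(-k-1) |B(Γ; ρ)|.
-- On the other hand |B(Γ; ρ)| ≤ 4^k |B(Γ; ρ/2)|: sorting B(Γ; ρ) by the quadrant
-- of [-ρ, ρ] that contains each centred character value γ(y) ∈ (-½, ½] gives 4^k
-- cells, and two elements of one cell differ by an element of B(Γ; ρ/2).
-- As x ∈ B(Γ; ρ/2), the two bounds are incompatible. The characters in Γ need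
-- not be distinct.

open import Defs

module Circle where

  open import Data.Bool.Base using (Bool; true; false)
  open import Data.Integer.Base as ℤ using (+_; -[1+_])
  import Data.Integer.Properties as ℤ
  open import Data.Nat.Base as ℕ using (suc)
  import Data.Nat.Properties as ℕ
  import Data.Nat.DivMod as ℕ
  open import Data.Product.Base using (∃; _×_; _,_)
  open import Data.Sum.Base using (_⊎_; inj₁; inj₂)
  open import Data.Rational.Base
  open import Data.Rational.Properties
  open import Data.Rational.Solver using (module +-*-Solver)
  open import Relation.Nullary.Decidable.Core using (yes; no)
  open import Relation.Nullary.Negation.Core using (contradiction)
  open import Relation.Binary.PropositionalEquality
  open import Function.Base using (_∘_)
  open import Function.Bundles using (_⇔_; Equivalence)
  open +-*-Solver

  ≤-by : ∀ {a b x y} → x ≤ y → a + y ≡ b + x → a ≤ b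
  ≤-by {a} {b} {x} {y} x≤y eq = begin
    a           ≡⟨ solve 2 (λ a y → a := (a :+ y) :- y) refl a y ⟩
    (a + y) - y ≡⟨ cong (_- y) eq ⟩
    (b + x) - y ≤⟨ +-monoˡ-≤ (- y) (+-monoʳ-≤ b x≤y) ⟩
    (b + y) - y ≡⟨ solve 2 (λ b y → (b :+ y) :- y := b) refl b y ⟩
    b           ∎
    where open ≤-Reasoning

  Reduced : ℚ → Set
  Reduced t = 0ℚ ≤ t × t < 1ℚ

  floor≡0 : ∀ {q} → Reduced q → floor q ≡ ℤ.0ℤ
  floor≡0 {mkℚ (+ m) d _} (_ , *<* m<d) =
    trans (ℤ.*-identityˡ (+ (m ℕ./ suc d))) (cong +_ (ℕ.m<n⇒m/n≡0 m<1+d))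
    where
    m<1+d : m ℕ.< suc d
    m<1+d = ℤ.drop‿+<+ (subst₂ ℤ._<_ (ℤ.*-identityʳ (+ m)) (ℤ.*-identityˡ (+ suc d)) m<d)
  floor≡0 {mkℚ -[1+ m ] d _} (*≤* () , _)

  floor≡1 : ∀ {q} → 1ℚ ≤ q → q < 1ℚ + 1ℚ → floor q ≡ ℤ.1ℤ
  floor≡1 {mkℚ (+ m) d _} (*≤* d≤m) (*<* m<2d) =
    trans (ℤ.*-identityˡ (+ (m ℕ./ suc d)))
          (cong +_ (trans (ℕ.m/n≡1+[m∸n]/n 1+d≤m) (cong suc (ℕ.m<n⇒m/n≡0 m∸[1+d]<1+d))))
    where
    1+d≤m : suc d ℕ.≤ m
    1+d≤m = ℤ.drop‿+≤+ (subst₂ ℤ._≤_ (ℤ.*-identityˡ (+ suc d)) (ℤ.*-identityʳ (+ m)) d≤m)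
    m<2[1+d] : m ℕ.< 2 ℕ.* suc d
    m<2[1+d] = ℤ.drop‿+<+ (subst₂ ℤ._<_ (ℤ.*-identityʳ (+ m)) refl m<2d)
    m∸[1+d]<1+d : m ℕ.∸ suc d ℕ.< suc d
    m∸[1+d]<1+d = subst (m ℕ.∸ suc d ℕ.<_)
      (trans (cong (λ n → suc d ℕ.+ n ℕ.∸ suc d) (ℕ.+-identityʳ (suc d))) (ℕ.m+n∸m≡n (suc d) (suc d)))
      (ℕ.∸-monoˡ-< m<2[1+d] 1+d≤m)
  floor≡1 {mkℚ -[1+ m ] d _} (*≤* ()) _

  frac≡q : ∀ {q} → Reduced q → frac q ≡ q
  frac≡q {q} r rewrite floor≡0 r = +-identityʳ q

  frac≡q-1 : ∀ {q} → 1ℚ ≤ q → q < 1ℚ + 1ℚ → frac q ≡ q - 1ℚ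
  frac≡q-1 1≤q q<2 rewrite floor≡1 1≤q q<2 = refl

  bit : Bool → ℚ
  bit false = 0ℚ
  bit true  = 1ℚ

  frac-+ : ∀ {s t} → Reduced s → Reduced t → ∃ λ e → frac (s + t) ≡ s + t - bit e
  frac-+ {s} {t} (0≤s , s<1) (0≤t , t<1) with s + t <? 1ℚ
  ... | yes s+t<1 = false , trans (frac≡q (+-mono-≤ 0≤s 0≤t , s+t<1)) (sym (+-identityʳ (s + t)))
  ... | no  s+t≮1 = true , frac≡q-1 (≮⇒≥ s+t≮1) (+-mono-< s<1 t<1)

  ∣∣𝕋-reduced : ∀ {t} → Reduced t → ∣ t ∣𝕋 ≡ t ⊓ (1ℚ - t)
  ∣∣𝕋-reduced r = cong (λ u → u ⊓ (1ℚ - u)) (frac≡q r)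

  centre : ℚ → ℚ
  centre t with ½ <? t
  ... | yes _ = t - 1ℚ
  ... | no  _ = t

  centre-offset : ∀ t → ∃ λ e → centre t ≡ t - bit e
  centre-offset t with ½ <? t
  ... | yes _ = true , refl
  ... | no  _ = false , sym (+-identityʳ t)

  ∣∣𝕋≡∣centre∣ : ∀ {t} → Reduced t → ∣ t ∣𝕋 ≡ ∣ centre t ∣
  ∣∣𝕋≡∣centre∣ {t} r@(0≤t , t<1) with ½ <? t
  ... | no ½≮t = begin
    ∣ t ∣𝕋          ≡⟨ ∣∣𝕋-reduced r ⟩
    t ⊓ (1ℚ - t)    ≡⟨ p≤q⇒p⊓q≡p t≤1-t ⟩
    t               ≡⟨ sym (0≤p⇒∣p∣≡p 0≤t) ⟩
    ∣ t ∣           ∎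
    where
    open ≡-Reasoning
    t≤1-t : t ≤ 1ℚ - t
    t≤1-t = ≤-by (+-mono-≤ (≮⇒≥ ½≮t) (≮⇒≥ ½≮t))
                  (solve 1 (λ t → t :+ (con ½ :+ con ½) := (con 1ℚ :- t) :+ (t :+ t)) refl t)
  ... | yes ½<t = begin
    ∣ t ∣𝕋          ≡⟨ ∣∣𝕋-reduced r ⟩
    t ⊓ (1ℚ - t)    ≡⟨ p≥q⇒p⊓q≡q 1-t≤t ⟩
    1ℚ - t          ≡⟨ sym (0≤p⇒∣p∣≡p 0≤1-t) ⟩
    ∣ 1ℚ - t ∣      ≡⟨ sym (∣-p∣≡∣p∣ (1ℚ - t)) ⟩
    ∣ - (1ℚ - t) ∣  ≡⟨ cong ∣_∣ (solve 1 (λ t → :- (con 1ℚ :- t) := t :- con 1ℚ) refl t) ⟩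
    ∣ t - 1ℚ ∣      ∎
    where
    open ≡-Reasoning
    1-t≤t : 1ℚ - t ≤ t
    1-t≤t = ≤-by (+-mono-≤ (<⇒≤ ½<t) (<⇒≤ ½<t))
                  (solve 1 (λ t → (con 1ℚ :- t) :+ (t :+ t) := t :+ (con ½ :+ con ½)) refl t)
    0≤1-t : 0ℚ ≤ 1ℚ - t
    0≤1-t = ≤-by (<⇒≤ t<1) (solve 1 (λ t → con 0ℚ :+ con 1ℚ := (con 1ℚ :- t) :+ t) refl t)

  -- Distance to ℤ is at most the distance to any integer; here the integer is
  -- -k, and 0 ≤ k ⊎ k ≤ -1 is all we need to know about it.
  ∣∣𝕋≤∣+integer∣ : ∀ {u k} → Reduced u → 0ℚ ≤ k ⊎ k ≤ - 1ℚ → ∣ u ∣𝕋 ≤ ∣ u + k ∣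
  ∣∣𝕋≤∣+integer∣ {u} {k} r@(0≤u , u<1) (inj₁ 0≤k) = begin
    ∣ u ∣𝕋        ≡⟨ ∣∣𝕋-reduced r ⟩
    u ⊓ (1ℚ - u)  ≤⟨ p⊓q≤p u (1ℚ - u) ⟩
    u             ≤⟨ ≤-by 0≤k (solve 2 (λ u k → u :+ k := (u :+ k) :+ con 0ℚ) refl u k) ⟩
    u + k         ≡⟨ sym (0≤p⇒∣p∣≡p (+-mono-≤ 0≤u 0≤k)) ⟩
    ∣ u + k ∣     ∎
    where open ≤-Reasoning
  ∣∣𝕋≤∣+integer∣ {u} {k} r@(0≤u , u<1) (inj₂ k≤-1) = begin
    ∣ u ∣𝕋        ≡⟨ ∣∣𝕋-reduced r ⟩
    u ⊓ (1ℚ - u)  ≤⟨ p⊓q≤q u (1ℚ - u) ⟩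
    1ℚ - u        ≤⟨ 1-u≤-[u+k] ⟩
    - (u + k)     ≡⟨ sym (0≤p⇒∣p∣≡p 0≤-[u+k]) ⟩
    ∣ - (u + k) ∣ ≡⟨ ∣-p∣≡∣p∣ (u + k) ⟩
    ∣ u + k ∣     ∎
    where
    open ≤-Reasoning
    1-u≤-[u+k] : 1ℚ - u ≤ - (u + k)
    1-u≤-[u+k] = ≤-by k≤-1 (solve 2 (λ u k → (con 1ℚ :- u) :+ :- con 1ℚ := (:- (u :+ k)) :+ k) refl u k)
    0≤-[u+k] : 0ℚ ≤ - (u + k)
    0≤-[u+k] = ≤-trans
      (≤-by (<⇒≤ u<1) (solve 1 (λ u → con 0ℚ :+ con 1ℚ := (con 1ℚ :- u) :+ u) refl u)) 1-u≤-[u+k]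

  bit-offset-integral : ∀ a b c →
    0ℚ ≤ bit a - bit b - bit c ⊎ bit a - bit b - bit c ≤ - 1ℚ
  bit-offset-integral false false false = inj₁ (≤ᵇ⇒≤ _)
  bit-offset-integral false false true  = inj₂ (≤ᵇ⇒≤ _)
  bit-offset-integral false true  false = inj₂ (≤ᵇ⇒≤ _)
  bit-offset-integral false true  true  = inj₂ (≤ᵇ⇒≤ _)
  bit-offset-integral true  false false = inj₁ (≤ᵇ⇒≤ _)
  bit-offset-integral true  false true  = inj₁ (≤ᵇ⇒≤ _)
  bit-offset-integral true  true  false = inj₁ (≤ᵇ⇒≤ _)
  bit-offset-integral true  true  true  = inj₂ (≤ᵇ⇒≤ _)

  -q≤p≤q⇒∣p∣≤q : ∀ {p q} → - q ≤ p → p ≤ q → ∣ p ∣ ≤ q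
  -q≤p≤q⇒∣p∣≤q {p} {q} -q≤p p≤q with ∣p∣≡p∨∣p∣≡-p p
  ... | inj₁ ∣p∣≡p  = subst (_≤ q) (sym ∣p∣≡p) p≤q
  ... | inj₂ ∣p∣≡-p = subst (_≤ q) (sym ∣p∣≡-p)
    (≤-by -q≤p (solve 2 (λ p q → (:- p) :+ p := q :+ (:- q)) refl p q))

  interval-diameter : ∀ {a r x y} → a ≤ x → x ≤ a + r → a ≤ y → y ≤ a + r → ∣ x - y ∣ ≤ r
  interval-diameter {a} {r} {x} {y} a≤x x≤a+r a≤y y≤a+r = -q≤p≤q⇒∣p∣≤q
    (≤-by (+-mono-≤ y≤a+r a≤x)
      (solve 4 (λ a r x y → (:- r) :+ ((a :+ r) :+ x) := (x :- y) :+ (y :+ a)) refl a r x y))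
    (≤-by (+-mono-≤ x≤a+r a≤y)
      (solve 4 (λ a r x y → (x :- y) :+ ((a :+ r) :+ y) := r :+ (x :+ a)) refl a r x y))

  ∣p∣≡-p : ∀ {p} → p < 0ℚ → ∣ p ∣ ≡ - p
  ∣p∣≡-p {p} p<0 with ∣p∣≡p∨∣p∣≡-p p
  ... | inj₁ ∣p∣≡p  = contradiction (<-≤-trans p<0 (∣p∣≡p⇒0≤p ∣p∣≡p)) (<-irrefl refl)
  ... | inj₂ ∣p∣≡-p = ∣p∣≡-p

  same-sign⇒∣p-q∣≡∣∣p∣-∣q∣∣ : ∀ {p q} → (0ℚ ≤ p ⇔ 0ℚ ≤ q) → ∣ p - q ∣ ≡ ∣ ∣ p ∣ - ∣ q ∣ ∣
  same-sign⇒∣p-q∣≡∣∣p∣-∣q∣∣ {p} {q} same-sign with 0ℚ ≤? p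
  ... | yes 0≤p rewrite 0≤p⇒∣p∣≡p 0≤p | 0≤p⇒∣p∣≡p (Equivalence.to same-sign 0≤p) = refl
  ... | no  0≰p rewrite ∣p∣≡-p (≰⇒> 0≰p) | ∣p∣≡-p (≰⇒> (0≰p ∘ Equivalence.from same-sign)) = begin
    ∣ p - q ∣         ≡⟨ sym (∣-p∣≡∣p∣ (p - q)) ⟩
    ∣ - (p - q) ∣     ≡⟨ cong ∣_∣ (solve 2 (λ p q → :- (p :- q) := (:- p) :- (:- q)) refl p q) ⟩
    ∣ - p - - q ∣     ∎
    where open ≡-Reasoning

  same-band⇒∣p-q∣≤r : ∀ {p q r} → 0ℚ ≤ p → 0ℚ ≤ q → p ≤ r + r → q ≤ r + r →
    (r ≤ p ⇔ r ≤ q) → ∣ p - q ∣ ≤ r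
  same-band⇒∣p-q∣≤r {p} {q} {r} 0≤p 0≤q p≤2r q≤2r same-band with r ≤? p
  ... | yes r≤p = interval-diameter r≤p p≤2r (Equivalence.to same-band r≤p) q≤2r
  ... | no  r≰p = interval-diameter 0≤p (below r≰p) 0≤q (below (r≰p ∘ Equivalence.from same-band))
    where
    below : ∀ {x} → r ≰ x → x ≤ 0ℚ + r
    below r≰x = subst (_ ≤_) (sym (+-identityˡ r)) (<⇒≤ (≰⇒> r≰x))

  -- The four quadrants [-2r,-r], [-r,0], [0,r], [r,2r] have diameter r.
  quadrant-diameter : ∀ {p q r} → ∣ p ∣ ≤ r + r → ∣ q ∣ ≤ r + r →
    (0ℚ ≤ p ⇔ 0ℚ ≤ q) → (r ≤ ∣ p ∣ ⇔ r ≤ ∣ q ∣) → ∣ p - q ∣ ≤ r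
  quadrant-diameter {p} {q} {r} ∣p∣≤2r ∣q∣≤2r same-sign same-band =
    subst (_≤ r) (sym (same-sign⇒∣p-q∣≡∣∣p∣-∣q∣∣ same-sign))
      (same-band⇒∣p-q∣≤r (0≤∣p∣ p) (0≤∣p∣ q) ∣p∣≤2r ∣q∣≤2r same-band)

  ∣∣𝕋≤∣centre+centre∣ : ∀ s t {u} → Reduced u → (∃ λ e → u ≡ s + t - bit e) →
    ∣ u ∣𝕋 ≤ ∣ centre s + centre t ∣
  ∣∣𝕋≤∣centre+centre∣ s t {u} reduced (e , u≡s+t-e) with centre-offset s | centre-offset t
  ... | e₁ , cs≡s-e₁ | e₂ , ct≡t-e₂ =
    subst (λ x → ∣ u ∣𝕋 ≤ ∣ x ∣) (sym cs+ct≡) (∣∣𝕋≤∣+integer∣ reduced (bit-offset-integral e e₁ e₂))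
    where
    open ≡-Reasoning
    cs+ct≡ : centre s + centre t ≡ u + (bit e - bit e₁ - bit e₂)
    cs+ct≡ = begin
      centre s + centre t                          ≡⟨ cong₂ _+_ cs≡s-e₁ ct≡t-e₂ ⟩
      (s - bit e₁) + (t - bit e₂)                  ≡⟨ solve 5 (λ s t e e₁ e₂ →
        (s :- e₁) :+ (t :- e₂) := (s :+ t :- e) :+ (e :- e₁ :- e₂)) refl s t (bit e) (bit e₁) (bit e₂) ⟩
      (s + t - bit e) + (bit e - bit e₁ - bit e₂)  ≡⟨ cong (_+ _) (sym u≡s+t-e) ⟩
      u + (bit e - bit e₁ - bit e₂)                ∎

  ∣∣𝕋≤∣centre-centre∣ : ∀ s t {u} → Reduced u → (∃ λ e → s ≡ u + t - bit e) →
    ∣ u ∣𝕋 ≤ ∣ centre s - centre t ∣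
  ∣∣𝕋≤∣centre-centre∣ s t {u} reduced (e , s≡u+t-e) with centre-offset s | centre-offset t
  ... | e₁ , cs≡s-e₁ | e₂ , ct≡t-e₂ =
    subst (λ x → ∣ u ∣𝕋 ≤ ∣ x ∣) (sym cs-ct≡) (∣∣𝕋≤∣+integer∣ reduced (bit-offset-integral e₂ e e₁))
    where
    open ≡-Reasoning
    cs-ct≡ : centre s - centre t ≡ u + (bit e₂ - bit e - bit e₁)
    cs-ct≡ = begin
      centre s - centre t                           ≡⟨ cong₂ _-_ cs≡s-e₁ ct≡t-e₂ ⟩
      (s - bit e₁) - (t - bit e₂)                   ≡⟨ cong (λ x → (x - bit e₁) - (t - bit e₂)) s≡u+t-e ⟩
      (u + t - bit e - bit e₁) - (t - bit e₂)       ≡⟨ solve 5 (λ u t e e₁ e₂ →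
        (u :+ t :- e :- e₁) :- (t :- e₂) := u :+ (e₂ :- e :- e₁)) refl u t (bit e) (bit e₁) (bit e₂) ⟩
      u + (bit e₂ - bit e - bit e₁)                 ∎

  p*½+p*½≡p : ∀ p → p * ½ + p * ½ ≡ p
  p*½+p*½≡p p = solve 1 (λ p → p :* con ½ :+ p :* con ½ := p) refl p

  0≤p⇒p*½≤p : ∀ {p} → 0ℚ ≤ p → p * ½ ≤ p
  0≤p⇒p*½≤p {p} 0≤p = ≤-by (*-monoʳ-≤-nonNeg ½ 0≤p)
    (solve 1 (λ p → p :* con ½ :+ p :* con ½ := p :+ con 0ℚ) refl p)

module Counting where

  open import Data.Bool.Base using (Bool; true; false; if_then_else_)
  open import Data.Nat.Base using (suc; _+_; _<_; _≤_; z≤n; s≤s)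
  import Data.Nat.Properties as ℕ
  open import Data.Fin.Base using (Fin)
  open import Data.Fin.Permutation using (Permutation; _⟨$⟩ʳ_)
  open import Data.Fin.Subset using (Subset; _∈_; _⊆_; ∣_∣; _∩_; _∪_; ∁)
  open import Data.Fin.Subset.Properties using (x∈p⇒∣p-x∣<∣p∣; p⊆q⇒∣p∣≤∣q∣; x∈p∩q⁺)
  open import Data.Product.Base using (_,_)
  open import Data.Vec.Base using ([]; _∷_; lookup; tabulate)
  import Data.Vec.Properties as Vec
  open import Algebra.Properties.CommutativeMonoid.Sum ℕ.+-0-commutativeMonoid
    using (sum-syntax; sum-permute; sum-cong-≗)
  open import Function.Base using (_∘_)
  open import Relation.Binary.PropositionalEquality

  ∣p∣≡∑ : ∀ {n} (p : Subset n) → ∣ p ∣ ≡ ∑[ i < n ] (if lookup p i then 1 else 0)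
  ∣p∣≡∑ []          = refl
  ∣p∣≡∑ (true  ∷ p) = cong suc (∣p∣≡∑ p)
  ∣p∣≡∑ (false ∷ p) = ∣p∣≡∑ p

  ∣p∘π∣≡∣p∣ : ∀ {n} (π : Permutation n n) (p : Subset n) →
    ∣ tabulate (lookup p ∘ (π ⟨$⟩ʳ_)) ∣ ≡ ∣ p ∣
  ∣p∘π∣≡∣p∣ {n} π p = begin
    ∣ tabulate p∘π ∣                                       ≡⟨ ∣p∣≡∑ (tabulate p∘π) ⟩
    ∑[ i < n ] (if lookup (tabulate p∘π) i then 1 else 0)  ≡⟨ sum-cong-≗ lookup-p∘π ⟩
    ∑[ i < n ] (if lookup p (π ⟨$⟩ʳ i) then 1 else 0)      ≡⟨ sum-permute (λ i → if lookup p i then 1 else 0) π ⟨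
    ∑[ i < n ] (if lookup p i then 1 else 0)               ≡⟨ ∣p∣≡∑ p ⟨
    ∣ p ∣                                                  ∎
    where
    open ≡-Reasoning
    p∘π : Fin n → Bool
    p∘π = lookup p ∘ (π ⟨$⟩ʳ_)
    lookup-p∘π : ∀ i → (if lookup (tabulate p∘π) i then 1 else 0) ≡ (if p∘π i then 1 else 0)
    lookup-p∘π i = cong (if_then 1 else 0) (Vec.lookup∘tabulate p∘π i)

  ∣p∩q∣+∣p∩∁q∣≡∣p∣ : ∀ {n} (p q : Subset n) → ∣ p ∩ q ∣ + ∣ p ∩ ∁ q ∣ ≡ ∣ p ∣
  ∣p∩q∣+∣p∩∁q∣≡∣p∣ []          []          = refl
  ∣p∩q∣+∣p∩∁q∣≡∣p∣ (true  ∷ p) (true  ∷ q) = cong suc (∣p∩q∣+∣p∩∁q∣≡∣p∣ p q)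
  ∣p∩q∣+∣p∩∁q∣≡∣p∣ (true  ∷ p) (false ∷ q) =
    trans (ℕ.+-suc ∣ p ∩ q ∣ ∣ p ∩ ∁ q ∣) (cong suc (∣p∩q∣+∣p∩∁q∣≡∣p∣ p q))
  ∣p∩q∣+∣p∩∁q∣≡∣p∣ (false ∷ p) (_     ∷ q) = ∣p∩q∣+∣p∩∁q∣≡∣p∣ p q

  ∣p∪q∣≤∣p∣+∣q∣ : ∀ {n} (p q : Subset n) → ∣ p ∪ q ∣ ≤ ∣ p ∣ + ∣ q ∣
  ∣p∪q∣≤∣p∣+∣q∣ []          []          = z≤n
  ∣p∪q∣≤∣p∣+∣q∣ (true  ∷ p) (true  ∷ q) =
    s≤s (ℕ.≤-trans (∣p∪q∣≤∣p∣+∣q∣ p q) (ℕ.+-monoʳ-≤ ∣ p ∣ (ℕ.n≤1+n ∣ q ∣)))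
  ∣p∪q∣≤∣p∣+∣q∣ (true  ∷ p) (false ∷ q) = s≤s (∣p∪q∣≤∣p∣+∣q∣ p q)
  ∣p∪q∣≤∣p∣+∣q∣ (false ∷ p) (true  ∷ q) =
    subst (suc ∣ p ∪ q ∣ ≤_) (sym (ℕ.+-suc ∣ p ∣ ∣ q ∣)) (s≤s (∣p∪q∣≤∣p∣+∣q∣ p q))
  ∣p∪q∣≤∣p∣+∣q∣ (false ∷ p) (false ∷ q) = ∣p∪q∣≤∣p∣+∣q∣ p q

  x∈p⇒0<∣p∣ : ∀ {n x} {p : Subset n} → x ∈ p → 0 < ∣ p ∣
  x∈p⇒0<∣p∣ x∈p = ℕ.≤-<-trans z≤n (x∈p⇒∣p-x∣<∣p∣ x∈p)

  ∈-tabulate⁺ : ∀ {n} {f : Fin n → Bool} {x} → f x ≡ true → x ∈ tabulate f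
  ∈-tabulate⁺ {f = f} {x} fx≡true = Vec.lookup⇒[]= x (tabulate f) (trans (Vec.lookup∘tabulate f x) fx≡true)

  ∈-tabulate⁻ : ∀ {n} {f : Fin n → Bool} {x} → x ∈ tabulate f → f x ≡ true
  ∈-tabulate⁻ {f = f} {x} x∈ = trans (sym (Vec.lookup∘tabulate f x)) (Vec.[]=⇒lookup x∈)

  p⊆q⇒∣p∣+∣q∩∁p∣≤∣q∣ : ∀ {n} {p q : Subset n} → p ⊆ q → ∣ p ∣ + ∣ q ∩ ∁ p ∣ ≤ ∣ q ∣
  p⊆q⇒∣p∣+∣q∩∁p∣≤∣q∣ {p = p} {q} p⊆q = begin
    ∣ p ∣ + ∣ q ∩ ∁ p ∣      ≤⟨ ℕ.+-monoˡ-≤ ∣ q ∩ ∁ p ∣ (p⊆q⇒∣p∣≤∣q∣ (λ x∈p → x∈p∩q⁺ (p⊆q x∈p , x∈p))) ⟩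
    ∣ q ∩ p ∣ + ∣ q ∩ ∁ p ∣  ≡⟨ ∣p∩q∣+∣p∩∁q∣≡∣p∣ q p ⟩
    ∣ q ∣                    ∎
    where open ℕ.≤-Reasoning

module Translates (G : FinAbGroup) where
  open Counting

  open import Data.Bool.Base using (Bool; false)
  open import Data.Bool.Properties using (¬-not)
  open import Data.Nat.Base using (zero; suc; _+_; _*_; _^_; _≤_; z≤n)
  import Data.Nat.Properties as ℕ
  open import Data.Fin.Base using (Fin; zero; suc)
  open import Data.Fin.Permutation using (Permutation; permutation)
  open import Data.Fin.Subset using (Subset; _∈_; _∉_; _⊆_; ∣_∣; _∩_; _∪_; ∁; ⊥; Empty)
  open import Data.Fin.Subset.Properties
    using ( p⊆q⇒∣p∣≤∣q∣; nonempty?; Empty-unique; ∣⊥∣≡0; x∈p∩q⁻; x∈p∩q⁺; x∈p∪q⁺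
          ; x∈∁p⇒x∉p; x∉p⇒x∈∁p; p∩q⊆p; _∈?_)
  open import Data.Vec.Base using (lookup; tabulate)
  import Data.Vec.Properties as Vec
  open import Data.Product.Base using (_,_; proj₂)
  open import Data.Sum.Base using (inj₁; inj₂)
  open import Algebra.Structures using (IsAbelianGroup)
  open import Relation.Nullary.Decidable.Core using (yes; no)
  open import Relation.Binary.PropositionalEquality
  open import Function.Base using (_∘_)

  open FinAbGroup G
  open IsAbelianGroup isAbelianGroup using (assoc; identityʳ; inverseˡ; inverseʳ; comm)

  ⊖-∙-cancel : ∀ a b → (a ⊖ b) ∙ b ≡ a
  ⊖-∙-cancel a b = trans (assoc a (b ⁻¹) b) (trans (cong (a ∙_) (inverseˡ b)) (identityʳ a))

  ∙-⊖-cancel : ∀ a b → (a ∙ b) ⊖ b ≡ a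
  ∙-⊖-cancel a b = trans (assoc a b (b ⁻¹)) (trans (cong (a ∙_) (inverseʳ b)) (identityʳ a))

  ∙-⊖-cancelˡ : ∀ a b → (a ∙ b) ⊖ a ≡ b
  ∙-⊖-cancelˡ a b = trans (cong (_⊖ a) (comm a b)) (∙-⊖-cancel b a)

  translation : Fin order → Permutation order order
  translation g = permutation (_∙ g) (_⊖ g) (λ a → ⊖-∙-cancel a g) (λ a → ∙-⊖-cancel a g)

  shift : Fin order → Subset order → Subset order
  shift g p = tabulate (λ a → lookup p (a ∙ g))

  ∈-shift⁺ : ∀ {g p a} → a ∙ g ∈ p → a ∈ shift g p
  ∈-shift⁺ {g} {p} {a} a∙g∈p = ∈-tabulate⁺ (Vec.[]=⇒lookup a∙g∈p)

  ∈-shift⁻ : ∀ {g p a} → a ∈ shift g p → a ∙ g ∈ p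
  ∈-shift⁻ {g} {p} {a} a∈ = Vec.lookup⇒[]= (a ∙ g) p (∈-tabulate⁻ a∈)

  ∣shift∣ : ∀ g p → ∣ shift g p ∣ ≡ ∣ p ∣
  ∣shift∣ g = ∣p∘π∣≡∣p∣ (translation g)

  S-S⊆T⇒∣S∣≤∣T∣ : ∀ {S T} → (∀ {a b} → a ∈ S → b ∈ S → a ⊖ b ∈ T) → ∣ S ∣ ≤ ∣ T ∣
  S-S⊆T⇒∣S∣≤∣T∣ {S} {T} S-S⊆T with nonempty? S
  ... | yes (b , b∈S) = begin
    ∣ S ∣              ≤⟨ p⊆q⇒∣p∣≤∣q∣ (λ a∈S → ∈-shift⁺ (S-S⊆T a∈S b∈S)) ⟩
    ∣ shift (b ⁻¹) T ∣ ≡⟨ ∣shift∣ (b ⁻¹) T ⟩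
    ∣ T ∣              ∎
    where open ℕ.≤-Reasoning
  ... | no S-empty = begin
    ∣ S ∣ ≡⟨ cong ∣_∣ (Empty-unique S-empty) ⟩
    ∣ ⊥ {order} ∣ ≡⟨ ∣⊥∣≡0 order ⟩
    0     ≤⟨ z≤n ⟩
    ∣ T ∣ ∎
    where open ℕ.≤-Reasoning

  cellwise-S-S⊆T⇒∣S∣≤2^m*∣T∣ : ∀ m (F : Fin m → Fin order → Bool) {S T} →
    (∀ {a b} → a ∈ S → b ∈ S → (∀ j → F j a ≡ F j b) → a ⊖ b ∈ T) → ∣ S ∣ ≤ 2 ^ m * ∣ T ∣
  cellwise-S-S⊆T⇒∣S∣≤2^m*∣T∣ zero F {S} {T} S-S⊆T =
    ℕ.≤-trans (S-S⊆T⇒∣S∣≤∣T∣ (λ a∈S b∈S → S-S⊆T a∈S b∈S (λ ()))) (ℕ.≤-reflexive (sym (ℕ.*-identityˡ ∣ T ∣)))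
  cellwise-S-S⊆T⇒∣S∣≤2^m*∣T∣ (suc m) F {S} {T} S-S⊆T = begin
    ∣ S ∣                                ≡⟨ ∣p∩q∣+∣p∩∁q∣≡∣p∣ S H ⟨
    ∣ S ∩ H ∣ + ∣ S ∩ ∁ H ∣              ≤⟨ ℕ.+-mono-≤ (cell (S ∩ H) (p∩q⊆p S H) on)
                                                       (cell (S ∩ ∁ H) (p∩q⊆p S (∁ H)) off) ⟩
    2 ^ m * ∣ T ∣ + 2 ^ m * ∣ T ∣        ≡⟨ cong (2 ^ m * ∣ T ∣ +_) (ℕ.+-identityʳ (2 ^ m * ∣ T ∣)) ⟨
    2 * (2 ^ m * ∣ T ∣)                  ≡⟨ ℕ.*-assoc 2 (2 ^ m) ∣ T ∣ ⟨
    2 ^ suc m * ∣ T ∣                    ∎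
    where
    open ℕ.≤-Reasoning
    H : Subset order
    H = tabulate (F zero)
    cell : ∀ C → C ⊆ S → (∀ {a b} → a ∈ C → b ∈ C → F zero a ≡ F zero b) → ∣ C ∣ ≤ 2 ^ m * ∣ T ∣
    cell C C⊆S same = cellwise-S-S⊆T⇒∣S∣≤2^m*∣T∣ m (F ∘ suc) λ a∈C b∈C agree →
      S-S⊆T (C⊆S a∈C) (C⊆S b∈C) λ { zero → same a∈C b∈C ; (suc j) → agree j }
    on : ∀ {a b} → a ∈ S ∩ H → b ∈ S ∩ H → F zero a ≡ F zero b
    on a∈ b∈ = trans (∈-tabulate⁻ (proj₂ (x∈p∩q⁻ S H a∈))) (sym (∈-tabulate⁻ (proj₂ (x∈p∩q⁻ S H b∈))))
    off : ∀ {a b} → a ∈ S ∩ ∁ H → b ∈ S ∩ ∁ H → F zero a ≡ F zero b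
    off a∈ b∈ = trans (outside a∈) (sym (outside b∈))
      where
      outside : ∀ {x} → x ∈ S ∩ ∁ H → F zero x ≡ false
      outside x∈ = ¬-not (x∈∁p⇒x∉p (proj₂ (x∈p∩q⁻ S (∁ H) x∈)) ∘ ∈-tabulate⁺)

  -- If no y ∈ A has y ∙ x ∈ A, then each y ∈ R has y or y ∙ x in B ∩ ∁ A.
  A∩shift-empty⇒∣R∣≤2∣B∩∁A∣ : ∀ {x R B A} → R ⊆ B → R ⊆ shift x B → Empty (A ∩ shift x A) →
    ∣ R ∣ ≤ ∣ B ∩ ∁ A ∣ + ∣ B ∩ ∁ A ∣
  A∩shift-empty⇒∣R∣≤2∣B∩∁A∣ {x} {R} {B} {A} R⊆B R⊆B-x A∩[A-x]-empty = begin
    ∣ R ∣                  ≤⟨ p⊆q⇒∣p∣≤∣q∣ R⊆D∪[D-x] ⟩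
    ∣ D ∪ shift x D ∣      ≤⟨ ∣p∪q∣≤∣p∣+∣q∣ D (shift x D) ⟩
    ∣ D ∣ + ∣ shift x D ∣  ≡⟨ cong (∣ D ∣ +_) (∣shift∣ x D) ⟩
    ∣ D ∣ + ∣ D ∣          ∎
    where
    open ℕ.≤-Reasoning
    D : Subset order
    D = B ∩ ∁ A
    R⊆D∪[D-x] : R ⊆ D ∪ shift x D
    R⊆D∪[D-x] {y} y∈R with y ∈? A
    ... | no  y∉A = x∈p∪q⁺ (inj₁ (x∈p∩q⁺ (R⊆B y∈R , x∉p⇒x∈∁p y∉A)))
    ... | yes y∈A = x∈p∪q⁺ (inj₂ (∈-shift⁺ {x} {D} (x∈p∩q⁺ (∈-shift⁻ {x} {B} (R⊆B-x y∈R) , x∉p⇒x∈∁p y∙x∉A))))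
      where
      y∙x∉A : y ∙ x ∉ A
      y∙x∉A y∙x∈A = A∩[A-x]-empty (y , x∈p∩q⁺ (y∈A , ∈-shift⁺ {x} {A} y∙x∈A))

module BohrSets (G : FinAbGroup) where
  open Circle
  open Counting

  open import Data.Bool.Base using (Bool; true; _∧_)
  open import Data.Bool.Properties using (∧-conicalˡ; ∧-conicalʳ)
  open import Data.Nat.Base as ℕ using (zero; suc; _^_)
  import Data.Nat.Properties as ℕ
  open import Data.Fin.Base using (Fin; zero; suc; splitAt)
  open import Data.Fin.Properties using (splitAt-↑ˡ; splitAt-↑ʳ)
  open import Data.Fin.Subset using (_∈_; _⊆_; ∣_∣)
  open import Data.Vec.Base using (lookup)
  import Data.Vec.Properties as Vec
  open import Data.Product.Base using (∃; map₂)
  open import Data.Sum.Base using (_⊎_; inj₁; inj₂)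
  open import Data.Rational.Base as ℚ using (ℚ; 0ℚ; ½; _+_; _-_; _*_; _≤_)
  open import Data.Rational.Properties using (_≤?_; ≤-trans; +-mono-≤; ∣p+q∣≤∣p∣+∣q∣; module ≤-Reasoning)
  open import Function.Base using (_∘_)
  open import Function.Bundles using (_⇔_; mk⇔)
  open import Relation.Nullary.Decidable.Core using (Dec; does; yes; no)
  open import Relation.Binary.PropositionalEquality
  open import Relation.Nullary.Decidable using (dec-true)
  open import Relation.Nullary.Negation.Core using (contradiction)

  does≡true⇒ : ∀ {A : Set} (a? : Dec A) → does a? ≡ true → A
  does≡true⇒ (yes a) _ = a

  does-≡⇒⇔ : ∀ {A B : Set} (a? : Dec A) (b? : Dec B) → does a? ≡ does b? → A ⇔ B
  does-≡⇒⇔ (yes a) (yes b) _ = mk⇔ (λ _ → b) (λ _ → a)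
  does-≡⇒⇔ (no ¬a) (no ¬b) _ = mk⇔ (λ a → contradiction a ¬a) (λ b → contradiction b ¬b)

  open Translates G
  open FinAbGroup G

  χ-∙ : (γ : Character G) (a b : Fin order) → ∃ λ e → χ γ (a ∙ b) ≡ χ γ a + χ γ b - bit e
  χ-∙ γ a b = map₂ (trans (hom γ a b)) (frac-+ (range γ a) (range γ b))

  ∣χ[a∙b]∣𝕋≤ : ∀ γ a b → ∣ χ γ (a ∙ b) ∣𝕋 ≤ ∣ χ γ a ∣𝕋 + ∣ χ γ b ∣𝕋
  ∣χ[a∙b]∣𝕋≤ γ a b = begin
    ∣ χ γ (a ∙ b) ∣𝕋
      ≤⟨ ∣∣𝕋≤∣centre+centre∣ (χ γ a) (χ γ b) (range γ (a ∙ b)) (χ-∙ γ a b) ⟩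
    ℚ.∣ centre (χ γ a) + centre (χ γ b) ∣
      ≤⟨ ∣p+q∣≤∣p∣+∣q∣ (centre (χ γ a)) (centre (χ γ b)) ⟩
    ℚ.∣ centre (χ γ a) ∣ + ℚ.∣ centre (χ γ b) ∣
      ≡⟨ cong₂ _+_ (∣∣𝕋≡∣centre∣ (range γ a)) (∣∣𝕋≡∣centre∣ (range γ b)) ⟨
    ∣ χ γ a ∣𝕋 + ∣ χ γ b ∣𝕋
      ∎
    where open ≤-Reasoning

  ∣χ[a⊖b]∣𝕋≤ : ∀ γ a b → ∣ χ γ (a ⊖ b) ∣𝕋 ≤ ℚ.∣ centre (χ γ a) - centre (χ γ b) ∣
  ∣χ[a⊖b]∣𝕋≤ γ a b = ∣∣𝕋≤∣centre-centre∣ (χ γ a) (χ γ b) (range γ (a ⊖ b))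
    (map₂ (trans (cong (χ γ) (sym (⊖-∙-cancel a b)))) (χ-∙ γ (a ⊖ b) b))

  lookup-bohr-suc : ∀ {k} (Γ : Fin (suc k) → Character G) ρ x →
    lookup (bohr G Γ ρ) x ≡ does (∣ χ (Γ zero) x ∣𝕋 ≤? ρ) ∧ lookup (bohr G (Γ ∘ suc) ρ) x
  lookup-bohr-suc Γ ρ x = trans (Vec.lookup∘tabulate _ x)
    (cong (does (∣ χ (Γ zero) x ∣𝕋 ≤? ρ) ∧_) (sym (Vec.lookup∘tabulate _ x)))

  ∈-bohr⁻ : ∀ {k} (Γ : Fin k → Character G) ρ {x} → x ∈ bohr G Γ ρ → ∀ i → ∣ χ (Γ i) x ∣𝕋 ≤ ρ
  ∈-bohr⁻ Γ ρ {x} x∈B zero    =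
    does≡true⇒ (_ ≤? ρ) (∧-conicalˡ _ _ (trans (sym (lookup-bohr-suc Γ ρ x)) (Vec.[]=⇒lookup x∈B)))
  ∈-bohr⁻ Γ ρ {x} x∈B (suc i) = ∈-bohr⁻ (Γ ∘ suc) ρ
    (Vec.lookup⇒[]= x _ (∧-conicalʳ _ _ (trans (sym (lookup-bohr-suc Γ ρ x)) (Vec.[]=⇒lookup x∈B)))) i

  ∈-bohr⁺ : ∀ {k} (Γ : Fin k → Character G) ρ {x} → (∀ i → ∣ χ (Γ i) x ∣𝕋 ≤ ρ) → x ∈ bohr G Γ ρ
  ∈-bohr⁺ {zero}  Γ ρ {x} _       = Vec.lookup⇒[]= x _ (Vec.lookup∘tabulate _ x)
  ∈-bohr⁺ {suc k} Γ ρ {x} bounded = Vec.lookup⇒[]= x _ (begin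
    lookup (bohr G Γ ρ) x
      ≡⟨ lookup-bohr-suc Γ ρ x ⟩
    does (∣ χ (Γ zero) x ∣𝕋 ≤? ρ) ∧ lookup (bohr G (Γ ∘ suc) ρ) x
      ≡⟨ cong₂ _∧_ (dec-true (_ ≤? ρ) (bounded zero))
                   (Vec.[]=⇒lookup (∈-bohr⁺ (Γ ∘ suc) ρ (bounded ∘ suc))) ⟩
    true
      ∎)
    where open ≡-Reasoning

  bohr-mono : ∀ {k} (Γ : Fin k → Character G) {ρ ρ′} → ρ ≤ ρ′ → bohr G Γ ρ ⊆ bohr G Γ ρ′
  bohr-mono Γ {ρ} {ρ′} ρ≤ρ′ x∈ = ∈-bohr⁺ Γ ρ′ λ i → ≤-trans (∈-bohr⁻ Γ ρ x∈ i) ρ≤ρ′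

  bohr-∙ : ∀ {k} (Γ : Fin k → Character G) ρ ρ′ {a b} →
    a ∈ bohr G Γ ρ → b ∈ bohr G Γ ρ′ → a ∙ b ∈ bohr G Γ (ρ + ρ′)
  bohr-∙ Γ ρ ρ′ {a} {b} a∈ b∈ = ∈-bohr⁺ Γ (ρ + ρ′) λ i →
    ≤-trans (∣χ[a∙b]∣𝕋≤ (Γ i) a b) (+-mono-≤ (∈-bohr⁻ Γ ρ a∈ i) (∈-bohr⁻ Γ ρ′ b∈ i))

  bohr-doubling : ∀ {k} (Γ : Fin k → Character G) ρ →
    ∣ bohr G Γ ρ ∣ ℕ.≤ 4 ^ k ℕ.* ∣ bohr G Γ (ρ * ½) ∣
  bohr-doubling {k} Γ ρ =
    subst₂ (λ ρ′ c → ∣ bohr G Γ ρ′ ∣ ℕ.≤ c ℕ.* ∣ bohr G Γ r ∣) (p*½+p*½≡p ρ) 2^[k+k]≡4^k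
      (cellwise-S-S⊆T⇒∣S∣≤2^m*∣T∣ (k ℕ.+ k) (quadrant ∘ splitAt k) same-quadrants⇒close)
    where
    r : ℚ
    r = ρ * ½
    ψ : Fin k → Fin order → ℚ
    ψ i a = centre (χ (Γ i) a)
    quadrant : Fin k ⊎ Fin k → Fin order → Bool
    quadrant (inj₁ i) a = does (0ℚ ≤? ψ i a)
    quadrant (inj₂ i) a = does (r ≤? ℚ.∣ ψ i a ∣)
    radius : ∀ {x} → x ∈ bohr G Γ (r + r) → ∀ i → ℚ.∣ ψ i x ∣ ≤ r + r
    radius {x} x∈ i = subst (_≤ r + r) (∣∣𝕋≡∣centre∣ (range (Γ i) x)) (∈-bohr⁻ Γ (r + r) x∈ i)
    same-quadrants⇒close : ∀ {a b} → a ∈ bohr G Γ (r + r) → b ∈ bohr G Γ (r + r) →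
      (∀ j → quadrant (splitAt k j) a ≡ quadrant (splitAt k j) b) → a ⊖ b ∈ bohr G Γ r
    same-quadrants⇒close {a} {b} a∈ b∈ agree = ∈-bohr⁺ Γ r λ i → ≤-trans (∣χ[a⊖b]∣𝕋≤ (Γ i) a b)
      (quadrant-diameter (radius a∈ i) (radius b∈ i)
        (does-≡⇒⇔ (0ℚ ≤? ψ i a) (0ℚ ≤? ψ i b) (agree-on (splitAt-↑ˡ k i k)))
        (does-≡⇒⇔ (r ≤? ℚ.∣ ψ i a ∣) (r ≤? ℚ.∣ ψ i b ∣) (agree-on (splitAt-↑ʳ k k i))))
      where
      agree-on : ∀ {j s} → splitAt k j ≡ s → quadrant s a ≡ quadrant s b
      agree-on {j} refl = agree j
    2^[k+k]≡4^k : 2 ^ (k ℕ.+ k) ≡ 4 ^ k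
    2^[k+k]≡4^k = sym (trans (ℕ.^-*-assoc 2 2 k) (cong (λ n → 2 ^ (k ℕ.+ n)) (ℕ.+-identityʳ k)))

module DensityArithmetic where

  open import Data.Nat.Base
  open import Data.Nat.Properties
  open import Relation.Binary.PropositionalEquality
  open import Relation.Nullary.Negation.Core using (contradiction)

  complement-of-dense : ∀ Q {a b d} → (Q ∸ 1) * b ≤ Q * a → a + d ≤ b → Q * d ≤ b
  complement-of-dense zero    _ _ = z≤n
  complement-of-dense (suc q) {a} {b} {d} dense a+d≤b = +-cancelˡ-≤ (suc q * a) _ _ (begin
    suc q * a + suc q * d  ≡⟨ *-distribˡ-+ (suc q) a d ⟨
    suc q * (a + d)        ≤⟨ *-monoʳ-≤ (suc q) a+d≤b ⟩
    b + q * b              ≡⟨ +-comm b (q * b) ⟩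
    q * b + b              ≤⟨ +-monoˡ-≤ b dense ⟩
    suc q * a + b          ∎)
    where open ≤-Reasoning

  4*n≤2*n⇒n≡0 : ∀ n → 4 * n ≤ 2 * n → n ≡ 0
  4*n≤2*n⇒n≡0 zero    _  = refl
  4*n≤2*n⇒n≡0 (suc n) le = contradiction (*-cancelʳ-≤ 4 2 (suc n) le) λ { (s≤s (s≤s ())) }

  -- Applied with a = |A|, b = |B(Γ; ρ)|, c = |B(Γ; ρ/2)| and d = |B(Γ; ρ) ∖ A|.
  dense-counts⇒c≡0 : ∀ k {a b c d} → (4 ^ (k + 1) ∸ 1) * b ≤ 4 ^ (k + 1) * a → a + d ≤ b →
    b ≤ 4 ^ k * c → c ≤ d + d → c ≡ 0
  dense-counts⇒c≡0 k {a} {b} {c} {d} dense a+d≤b b≤4^kc c≤2d =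
    n≤0⇒n≡0 (≤-trans c≤2d (≤-reflexive (cong (λ n → n + n) d≡0)))
    where
    instance _ = m^n≢0 4 k
    4d≤2d : 4 * d ≤ 2 * d
    4d≤2d = *-cancelˡ-≤ (4 ^ k) (begin
      4 ^ k * (4 * d)      ≡⟨ *-assoc (4 ^ k) 4 d ⟨
      4 ^ k * 4 * d        ≡⟨ cong (_* d) (^-distribˡ-+-* 4 k 1) ⟨
      4 ^ (k + 1) * d      ≤⟨ complement-of-dense (4 ^ (k + 1)) dense a+d≤b ⟩
      b                    ≤⟨ b≤4^kc ⟩
      4 ^ k * c            ≤⟨ *-monoʳ-≤ (4 ^ k) c≤2d ⟩
      4 ^ k * (d + d)      ≡⟨ cong (λ n → 4 ^ k * (d + n)) (+-identityʳ d) ⟨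
      4 ^ k * (2 * d)      ∎)
      where open ≤-Reasoning
    d≡0 : d ≡ 0
    d≡0 = 4*n≤2*n⇒n≡0 d 4d≤2d

open import Data.Nat using (ℕ; _^_; _∸_; _≤_)
open import Data.Nat.Properties using (<⇒≢)
open import Data.Fin using (Fin)
open import Data.Fin.Subset using (Subset; _⊆_; _∈_; ∣_∣; _∩_)
open import Data.Fin.Subset.Properties using (nonempty?; x∈p∩q⁻)
open import Data.Rational using (ℚ; 0ℚ; ½; _<_; _*_)
open import Data.Rational.Properties using (<⇒≤)
open import Data.Product using (∃₂; _×_; _,_; proj₁; proj₂)
open import Relation.Nullary using (yes; no; contradiction)
open import Relation.Binary.PropositionalEquality using (_≡_; subst; sym)
open Circle using (p*½+p*½≡p; 0≤p⇒p*½≤p)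
open Counting using (x∈p⇒0<∣p∣; p⊆q⇒∣p∣+∣q∩∁p∣≤∣q∣)
open DensityArithmetic using (dense-counts⇒c≡0)

lemma4p2 : (G : FinAbGroup) (k : ℕ) (Γ : Fin k → Character G) →
  (∀ i j → (∀ x → χ (Γ i) x ≡ χ (Γ j) x) → i ≡ j) →
  (ρ : ℚ) → 0ℚ < ρ →
  (A : Subset (FinAbGroup.order G)) → A ⊆ bohr G Γ ρ →
  (4 ^ (k Data.Nat.+ 1) ∸ 1) Data.Nat.* ∣ bohr G Γ ρ ∣ ≤ 4 ^ (k Data.Nat.+ 1) Data.Nat.* ∣ A ∣ →
  ∀ x → x ∈ bohr G Γ (ρ * ½) →
  ∃₂ λ a b → a ∈ A × b ∈ A × FinAbGroup._⊖_ G a b ≡ x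
lemma4p2 G k Γ _ ρ 0<ρ A A⊆Bρ dense x x∈Bρ/2 with nonempty? (A ∩ Translates.shift G x A)
... | yes (y , y∈A∩[A-x]) = y ∙ x , y , ∈-shift⁻ {x} {A} y∈A-x , y∈A , ∙-⊖-cancelˡ y x
  where
  open FinAbGroup G
  open Translates G
  y∈A : y ∈ A
  y∈A = proj₁ (x∈p∩q⁻ A (shift x A) y∈A∩[A-x])
  y∈A-x : y ∈ shift x A
  y∈A-x = proj₂ (x∈p∩q⁻ A (shift x A) y∈A∩[A-x])
... | no A∩[A-x]-empty = contradiction (sym ∣Bρ/2∣≡0) (<⇒≢ (x∈p⇒0<∣p∣ x∈Bρ/2))
  where
  open FinAbGroup G
  open Translates G
  open BohrSets G
  Bρ/2⊆Bρ : bohr G Γ (ρ * ½) ⊆ bohr G Γ ρ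
  Bρ/2⊆Bρ = bohr-mono Γ (0≤p⇒p*½≤p (<⇒≤ 0<ρ))
  Bρ/2⊆Bρ-x : bohr G Γ (ρ * ½) ⊆ shift x (bohr G Γ ρ)
  Bρ/2⊆Bρ-x {y} y∈ = ∈-shift⁺ {x} {bohr G Γ ρ}
    (subst (λ ρ′ → y ∙ x ∈ bohr G Γ ρ′) (p*½+p*½≡p ρ) (bohr-∙ Γ (ρ * ½) (ρ * ½) y∈ x∈Bρ/2))
  ∣Bρ/2∣≡0 : ∣ bohr G Γ (ρ * ½) ∣ ≡ 0
  ∣Bρ/2∣≡0 = dense-counts⇒c≡0 k dense (p⊆q⇒∣p∣+∣q∩∁p∣≤∣q∣ A⊆Bρ) (bohr-doubling Γ ρ)
    (A∩shift-empty⇒∣R∣≤2∣B∩∁A∣ Bρ/2⊆Bρ Bρ/2⊆Bρ-x A∩[A-x]-empty)
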